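{- Let $\sigma$ be a permutation of $[n]$, $\mathcal{F} \subseteq \mathcal{P}([n])$ subset-closed, and $k \in [0,n]$. Then $\Phi^k_{\alpha \circ \sigma}(\mathcal{F}) = \Phi^k_{\beta \circ \sigma}(\mathcal{F})$.
   Context: $[n] = \{1,\dots,n\}$, $[0,n] = \{0,\dots,n\}$, $\mathcal{P}([n])$ is the power set, $\oplus$ is symmetric difference. A family is subset-closed if it contains every subset of each of its members. A shift operator $s$ assigns to each family $\mathcal{F} \subseteq \mathcal{P}([n])$ and each $A \in \mathcal{F}$ a set $s(\mathcal{F},A) \subseteq [n]$, injectively in $A$; write $s(\mathcal{F}) = \{s(\mathcal{F},A): A \in \mathcal{F}\}$. For a sequence of shift operators $(s_i)_{i\ge1}$ define $\Phi^0_s(\mathcal{F},A) = A$ and $\Phi^i_s(\mathcal{F},A) = s_i(\Phi^{i-1}_s(\mathcal{F}), \Phi^{i-1}_s(\mathcal{F},A))$, with $\Phi^i_s(\mathcal{F}) = \{\Phi^i_s(\mathcal{F},A) : A \in \mathcal{F}\}$. For $a \in [n]$ define the shift operators $\alpha_a(\mathcal{F}, A) = A \oplus \{a\}$ and $\beta_a(\mathcal{F},A) = A \cup \{a\}$ if $A \cup \{a\} \notin \mathcal{F}$, and $\beta_a(\mathcal{F},A) = A$ otherwise. For a permutation $\sigma$ of $[n]$, $\alpha \circ \sigma$ denotes the sequence $(\alpha_{\sigma(i)})_{i \in [n]}$ and $\beta\circ\sigma$ the sequence $(\beta_{\sigma(i)})_{i \in [n]}$. -}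

module Defs where

open import Data.Nat using (ℕ; zero; suc; _<?_)
open import Data.Bool using (Bool; true; not; if_then_else_)
open import Data.Bool.Properties using () renaming (_≟_ to _≟ᵇ_)
open import Data.Fin using (Fin; fromℕ<)
open import Data.Fin.Subset using (Subset; _⊆_)
open import Data.Fin.Permutation using (Permutation′; _⟨$⟩ʳ_)
open import Data.Vec using (_[_]%=_; _[_]≔_)
open import Data.Vec.Properties using (≡-dec)
open import Data.List using (List; map)
open import Data.List.Membership.Propositional using (_∈_)
import Data.List.Membership.DecPropositional as DecMem
open import Relation.Nullary using (yes; no; does)
open import Relation.Binary.PropositionalEquality using (_≡_)

-- A family of subsets of [n], represented as a finite list of subsets
-- (read as the set of its elements; duplicates are irrelevant).
Family : ℕ → Set
Family n = List (Subset n)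

_∈?ᶠ_ : ∀ {n} (A : Subset n) (F : Family n) → Bool
_∈?ᶠ_ {n} A F = does (DecMem._∈?_ (≡-dec _≟ᵇ_) A F)

SubsetClosed : ∀ {n} → Family n → Set
SubsetClosed F = ∀ {A B} → A ∈ F → B ⊆ A → B ∈ F

ShiftOp : ℕ → Set
ShiftOp n = Family n → Subset n → Subset n

α : ∀ {n} → Fin n → ShiftOp n
α a F A = A [ a ]%= not

β : ∀ {n} → Fin n → ShiftOp n
β a F A = if ((A [ a ]≔ true) ∈?ᶠ F) then A else (A [ a ]≔ true)

-- Sequences of shift operators are indexed 0-based: s i stands for s_{i+1}.
-- Φ i s F A = Φ^i_s(F, A), ΦF i s F = Φ^i_s(F).
mutual
  Φ : ∀ {n} → ℕ → (ℕ → ShiftOp n) → Family n → Subset n → Subset n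
  Φ zero    s F A = A
  Φ (suc i) s F A = s i (ΦF i s F) (Φ i s F A)

  ΦF : ∀ {n} → ℕ → (ℕ → ShiftOp n) → Family n → Family n
  ΦF i s F = map (Φ i s F) F

-- the identity shift, used only as a filler for indices ≥ n (never reached
-- when k ≤ n)
idShift : ∀ {n} → ShiftOp n
idShift F A = A

_∘ˢ_ : ∀ {n} → (Fin n → ShiftOp n) → Permutation′ n → ℕ → ShiftOp n
_∘ˢ_ {n} x σ i with i <? n
... | yes i<n = x (σ ⟨$⟩ʳ fromℕ< i<n)
... | no _    = idShift

-- α_a is an involution, so a set lies in the α_a-shift of a family G exactly
-- when its a-toggle lies in G.  If G is closed under deleting a, the β_a-shift
-- of G obeys the same rule, so one α-step and one β-step from set-equal
-- families give set-equal families.  The rule needs closure under deleting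
-- the coordinate being shifted; F has it for every coordinate, and α_a
-- preserves closure under deleting any b ≠ a, so before step i the α-family
-- is still closed under deleting every σ(j) with j ≥ i.
module Submission where

open import Defs
open import Data.Nat using (ℕ; zero; suc; _≤_; _<_; _<?_)
open import Data.Nat.Properties using (<⇒≤; <-irrefl; ≤-reflexive)
open import Data.Bool using (true; false; not)
open import Data.Bool.Properties using (not-involutive) renaming (_≟_ to _≟ᵇ_)
open import Data.Fin using (Fin; toℕ; fromℕ<; zero; suc)
open import Data.Fin.Properties using (toℕ-fromℕ<)
open import Data.Fin.Subset using (Subset; _⊆_)
open import Data.Fin.Permutation using (Permutation′; _⟨$⟩ʳ_; _⟨$⟩ˡ_; inverseˡ)
open import Data.Vec using (_∷_; lookup; _[_]%=_; _[_]≔_; here; there)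
open import Data.Vec.Properties
  using (≡-dec; updateAt-updateAt-local; updateAt-cong-local; updateAt-id-local; updateAt-commutes)
open import Data.List using (List; map)
open import Data.List.Properties using (map-∘; map-id)
open import Data.List.Membership.Propositional using (_∈_; _∉_)
open import Data.List.Membership.Propositional.Properties using (∈-map⁺; ∈-map⁻)
import Data.List.Membership.DecPropositional as DecMem
open import Data.List.Relation.Binary.BagAndSetEquality using (_∼[_]_; set)
open import Data.Product using (_×_; _,_; proj₁)
open import Function using (_∘_; id; _⇔_; mk⇔; Equivalence)
open import Function.Related.Propositional using (SK-sym; K-refl; module EquationalReasoning)
open import Relation.Nullary using (yes; no; contradiction)
open import Relation.Binary.PropositionalEquality

private
  variable
    n : ℕ

RemovalClosed : Fin n → Family n → Set
RemovalClosed b G = ∀ {B} → B ∈ G → B [ b ]≔ false ∈ G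

RemovalClosed-resp-∼ : ∀ {b : Fin n} {G H : Family n} →
  G ∼[ set ] H → RemovalClosed b G → RemovalClosed b H
RemovalClosed-resp-∼ G∼H closed B∈H =
  Equivalence.to G∼H (closed (Equivalence.from G∼H B∈H))

[]≔false-⊆ : (B : Subset n) (b : Fin n) → B [ b ]≔ false ⊆ B
[]≔false-⊆ (_ ∷ B) zero    (there x∈B) = there x∈B
[]≔false-⊆ (_ ∷ B) (suc b) here        = here
[]≔false-⊆ (_ ∷ B) (suc b) (there x∈B) = there ([]≔false-⊆ B b x∈B)

SubsetClosed⇒RemovalClosed : ∀ {F : Family n} → SubsetClosed F → ∀ b → RemovalClosed b F
SubsetClosed⇒RemovalClosed closed b {B} B∈F = closed B∈F ([]≔false-⊆ B b)

∈-map-involutive : ∀ {A : Set} {f : A → A} → (∀ x → f (f x) ≡ x) →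
  ∀ {x} (xs : List A) → x ∈ map f xs ⇔ f x ∈ xs
∈-map-involutive {f = f} f-invol {x} xs = mk⇔ to from
  where
  to : x ∈ map f xs → f x ∈ xs
  to x∈ with ∈-map⁻ f x∈
  ... | y , y∈xs , refl = subst (_∈ xs) (sym (f-invol y)) y∈xs
  from : f x ∈ xs → x ∈ map f xs
  from fx∈xs = subst (_∈ map f xs) (f-invol x) (∈-map⁺ f fx∈xs)

module _ (a : Fin n) where

  toggle-involutive : ∀ (X : Subset n) → X [ a ]%= not [ a ]%= not ≡ X
  toggle-involutive X = trans (updateAt-updateAt-local a {h = id} X (not-involutive (lookup X a)))
                              (updateAt-id-local a X refl)

  toggle-by-lookup : ∀ {X : Subset n} {b} → lookup X a ≡ b → X [ a ]%= not ≡ X [ a ]≔ not b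
  toggle-by-lookup {X} eq = updateAt-cong-local a X (cong not eq)

  []≔-lookup′ : ∀ {X : Subset n} {b} → lookup X a ≡ b → X [ a ]≔ b ≡ X
  []≔-lookup′ {X} eq = updateAt-id-local a X (sym eq)

  []≔-[]≔ : ∀ (X : Subset n) b c → X [ a ]≔ b [ a ]≔ c ≡ X [ a ]≔ c
  []≔-[]≔ X b c = updateAt-updateAt-local a X refl

  toggle-[]≔ : ∀ (X : Subset n) b → X [ a ]≔ b [ a ]%= not ≡ X [ a ]≔ not b
  toggle-[]≔ X b = updateAt-updateAt-local a X refl

  toggle-commutes-[]≔ : ∀ {b} → b ≢ a → ∀ (X : Subset n) c →
    X [ b ]≔ c [ a ]%= not ≡ X [ a ]%= not [ b ]≔ c
  toggle-commutes-[]≔ b≢a X c = updateAt-commutes a _ (b≢a ∘ sym) X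

module _ (a : Fin n) (G : Family n) where

  open DecMem {A = Subset n} (≡-dec _≟ᵇ_) using (_∈?_)

  ∈-map-α : ∀ {X} → X ∈ map (α a G) G ⇔ X [ a ]%= not ∈ G
  ∈-map-α = ∈-map-involutive (toggle-involutive a) G

  α-preserves-RemovalClosed : ∀ {b} → b ≢ a → RemovalClosed b G → RemovalClosed b (map (α a G) G)
  α-preserves-RemovalClosed b≢a closed {B} B∈ = Equivalence.from ∈-map-α
    (subst (_∈ G) (sym (toggle-commutes-[]≔ a b≢a B false)) (closed (Equivalence.to ∈-map-α B∈)))

  β-fixes : ∀ {A} → A [ a ]≔ true ∈ G → β a G A ≡ A
  β-fixes {A} A+a∈G with A [ a ]≔ true ∈? G
  ... | yes _      = refl
  ... | no A+a∉G = contradiction A+a∈G A+a∉G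

  β-adds : ∀ {A} → A [ a ]≔ true ∉ G → β a G A ≡ A [ a ]≔ true
  β-adds {A} A+a∉G with A [ a ]≔ true ∈? G
  ... | yes A+a∈G = contradiction A+a∈G A+a∉G
  ... | no _       = refl

  module _ (closed : RemovalClosed a G) where

    β-image-toggled∈ : ∀ {A} → A ∈ G → β a G A [ a ]%= not ∈ G
    β-image-toggled∈ {A} A∈G with A [ a ]≔ true ∈? G
    ... | no _ = subst (_∈ G) (sym (toggle-[]≔ a A true)) (closed A∈G)
    ... | yes A+a∈G with lookup A a in eq
    ...   | true  = subst (_∈ G) (sym (toggle-by-lookup a eq)) (closed A∈G)
    ...   | false = subst (_∈ G) (sym (toggle-by-lookup a eq)) A+a∈G

    toggled∈⇒∈-map-β : ∀ {X} → X [ a ]%= not ∈ G → X ∈ map (β a G) G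
    toggled∈⇒∈-map-β {X} X±a∈G with lookup X a in eq
    ... | false = subst (_∈ map (β a G) G) (β-fixes X+a∈G) (∈-map⁺ (β a G) X∈G)
      where
      X+a∈G : X [ a ]≔ true ∈ G
      X+a∈G = subst (_∈ G) (toggle-by-lookup a eq) X±a∈G
      X∈G : X ∈ G
      X∈G = subst (_∈ G) (trans ([]≔-[]≔ a X true false) ([]≔-lookup′ a eq)) (closed X+a∈G)
    ... | true with X ∈? G
    ...   | yes X∈G = subst (_∈ map (β a G) G) (β-fixes (subst (_∈ G) (sym ([]≔-lookup′ a eq)) X∈G))
                        (∈-map⁺ (β a G) X∈G)
    ...   | no X∉G = subst (_∈ map (β a G) G) (trans (β-adds (X∉G ∘ subst (_∈ G) X-a+a≡X)) X-a+a≡X)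
                       (∈-map⁺ (β a G) X±a∈G)
      where
      X-a+a≡X : X [ a ]%= not [ a ]≔ true ≡ X
      X-a+a≡X = trans (cong (_[ a ]≔ true) (toggle-by-lookup a eq))
                      (trans ([]≔-[]≔ a X false true) ([]≔-lookup′ a eq))

    ∈-map-β : ∀ {X} → X ∈ map (β a G) G ⇔ X [ a ]%= not ∈ G
    ∈-map-β {X} = mk⇔ to toggled∈⇒∈-map-β
      where
      to : X ∈ map (β a G) G → X [ a ]%= not ∈ G
      to X∈ with ∈-map⁻ (β a G) X∈
      ... | A , A∈G , refl = β-image-toggled∈ A∈G

∘ˢ-index : ∀ (x : Fin n → ShiftOp n) (σ : Permutation′ n) {i} (i<n : i < n) →
  (x ∘ˢ σ) i ≡ x (σ ⟨$⟩ʳ fromℕ< i<n)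
∘ˢ-index {n} x σ {i} i<n with i <? n
... | yes _   = refl
... | no i≮n = contradiction i<n i≮n

ΦF-suc : ∀ (s : ℕ → ShiftOp n) i F → ΦF (suc i) s F ≡ map (s i (ΦF i s F)) (ΦF i s F)
ΦF-suc s i F = map-∘ F

module _ (σ : Permutation′ n) (F : Family n) where

  ΦF-suc-∘ˢ : ∀ (x : Fin n → ShiftOp n) {i} (i<n : i < n) →
    let G = ΦF i (x ∘ˢ σ) F in ΦF (suc i) (x ∘ˢ σ) F ≡ map (x (σ ⟨$⟩ʳ fromℕ< i<n) G) G
  ΦF-suc-∘ˢ x {i} i<n = trans (ΦF-suc (x ∘ˢ σ) i F) (cong (λ s → map (s G) G) (∘ˢ-index x σ i<n))
    where G = ΦF i (x ∘ˢ σ) F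

  Stage : ℕ → Set
  Stage i = ΦF i (α ∘ˢ σ) F ∼[ set ] ΦF i (β ∘ˢ σ) F
          × (∀ b → i ≤ toℕ (σ ⟨$⟩ˡ b) → RemovalClosed b (ΦF i (α ∘ˢ σ) F))

  stage-zero : SubsetClosed F → Stage 0
  stage-zero closed = K-refl , λ b _ →
    subst (RemovalClosed b) (sym (map-id F)) (SubsetClosed⇒RemovalClosed closed b)

  stage-suc : ∀ {i} → i < n → Stage i → Stage (suc i)
  stage-suc {i} i<n (Gα∼Gβ , closedα) = shifts-agree , closedα′
    where
    open EquationalReasoning
    a = σ ⟨$⟩ʳ fromℕ< i<n
    Gα = ΦF i (α ∘ˢ σ) F
    Gβ = ΦF i (β ∘ˢ σ) F

    index-a : toℕ (σ ⟨$⟩ˡ a) ≡ i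
    index-a = trans (cong toℕ (inverseˡ σ)) (toℕ-fromℕ< i<n)

    closedβ-a : RemovalClosed a Gβ
    closedβ-a = RemovalClosed-resp-∼ Gα∼Gβ (closedα a (≤-reflexive (sym index-a)))

    shifts-agree : ΦF (suc i) (α ∘ˢ σ) F ∼[ set ] ΦF (suc i) (β ∘ˢ σ) F
    shifts-agree {X} = begin
      X ∈ ΦF (suc i) (α ∘ˢ σ) F ≡⟨ cong (X ∈_) (ΦF-suc-∘ˢ α i<n) ⟩
      X ∈ map (α a Gα) Gα       ∼⟨ ∈-map-α a Gα ⟩
      X [ a ]%= not ∈ Gα        ∼⟨ Gα∼Gβ ⟩
      X [ a ]%= not ∈ Gβ        ∼⟨ SK-sym (∈-map-β a Gβ closedβ-a) ⟩
      X ∈ map (β a Gβ) Gβ       ≡⟨ cong (X ∈_) (sym (ΦF-suc-∘ˢ β i<n)) ⟩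
      X ∈ ΦF (suc i) (β ∘ˢ σ) F ∎

    closedα′ : ∀ b → suc i ≤ toℕ (σ ⟨$⟩ˡ b) → RemovalClosed b (ΦF (suc i) (α ∘ˢ σ) F)
    closedα′ b i<b = subst (RemovalClosed b) (sym (ΦF-suc-∘ˢ α i<n))
      (α-preserves-RemovalClosed a Gα b≢a (closedα b (<⇒≤ i<b)))
      where
      b≢a : b ≢ a
      b≢a refl = <-irrefl (sym index-a) i<b

  stage : SubsetClosed F → ∀ i → i ≤ n → Stage i
  stage closed zero    _   = stage-zero closed
  stage closed (suc i) i<n = stage-suc i<n (stage closed i (<⇒≤ i<n))

mainTheorem3 : ∀ (n : ℕ) (σ : Permutation′ n) (F : Family n) → SubsetClosed F →
    ∀ (k : ℕ) → k ≤ n → ΦF k (α ∘ˢ σ) F ∼[ set ] ΦF k (β ∘ˢ σ) F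
mainTheorem3 n σ F closed k k≤n = proj₁ (stage σ F closed k k≤n)
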